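{- Let $\alpha_1,\ldots,\alpha_d,\beta_1,\ldots,\beta_d\in\mathbb{Q}\setminus\mathbb{Z}_{\ge0}$, let $A\uplus B$ be the multiset $\{\alpha_1,\ldots,\alpha_d,\beta_1,\ldots,\beta_d\}$, $b>0$ the least common denominator of its elements, and $N_r=b\sum_{\gamma\in A\uplus B}N_\gamma+1$. Let $p,q$ be primes with $p\equiv q\equiv1\pmod b$ and $q>p>N_r$. Let $\gamma,\gamma'\in A\uplus B$ with $\gamma\prec_r\gamma'$. Then $\gamma-\gamma'\notin\mathbb{Z}$ if and only if $$\mathrm{rem}_p(\gamma')-\mathrm{rem}_p(\gamma)<\mathrm{rem}_q(\gamma')-\mathrm{rem}_q(\gamma)$$ (as integers).
   Context: For a prime $p$, $\mathrm{rem}_p(x/y)=xy^{ -1}\bmod p\in\{0,\ldots,p-1\}$ for $x,y\in\mathbb{Z}$, $p\nmid y$. Each $\delta\in A\uplus B$ is uniquely written $\delta=e-\frac{f}{b}$ with $e\in\mathbb{Z}$, $f\in\{1,\ldots,b\}$, and $N_\delta=\max(e,\lceil\frac{be}{b-f}\rceil)$ if $e\ge1$, $N_\delta=\max(-e,\lceil\frac{ -be}{f}\rceil)$ if $e\le0$. For all primes $p\equiv1\pmod b$ with $p>N_r$, the strict orders $\prec_p$ on $A\uplus B$ given by $x\prec_p y\iff\mathrm{rem}_p(x)<\mathrm{rem}_p(y)$ coincide; $\prec_r$ denotes this common order. -}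

module Defs where

open import Data.Nat as ℕ using (ℕ; zero; suc; _∸_; _⊔_; _<_)
open import Data.Nat.LCM using (lcm)
open import Data.Nat.Divisibility using (_∣_)
open import Data.Nat.Primality using (Prime)
open import Data.Integer as ℤ using (ℤ; +_; -[1+_])
open import Data.Integer.DivMod using (_/ℕ_; _%ℕ_)
open import Data.Rational as ℚ using (ℚ; ↥_; ↧_; ↧ₙ_)
open import Data.List using (List; []; _∷_; _++_; map; foldr; filter; upTo)
open import Data.Nat.ListAction using (sum)
open import Data.Vec as Vec using (Vec)
open import Data.Product using (∃-syntax)
open import Relation.Nullary using (¬_)
open import Relation.Binary.PropositionalEquality using (_≡_)

NonNegInt : ℚ → Set
NonNegInt x = ∃[ n ] x ≡ ((+ n) ℚ./ 1)

IsInt : ℚ → Set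
IsInt x = ∃[ z ] x ≡ (z ℚ./ 1)

AB : ∀ {d} → Vec ℚ d → Vec ℚ d → List ℚ
AB α β = Vec.toList α ++ Vec.toList β

lcd : List ℚ → ℕ
lcd xs = foldr lcm 1 (map ↧ₙ_ xs)

-- rem_p(x/y) = x y^{-1} mod p : the unique r ∈ {0,…,p-1} with r·y ≡ x (mod p),
-- for x/y the reduced form of the rational (0 if none exists / p = 0).
remP : ℕ → ℚ → ℕ
remP zero    x = 0
remP p@(suc _) x = first (filter (λ r → ((+ r ℤ.* ↧ x ℤ.- ↥ x) %ℕ p) ℕ.≟ 0) (upTo p))
  where
  first : List ℕ → ℕ
  first []      = 0
  first (r ∷ _) = r

-- ⌈ n / k ⌉ for natural numbers (k = 0 gives 0; never used that way)
ceilDiv : ℕ → ℕ → ℕ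
ceilDiv n zero        = 0
ceilDiv n k@(suc k-1) = (n ℕ.+ k-1) ℕ./ k

-- For δ with δ·b ∈ ℤ, δ = e - f/b with e ∈ ℤ, f ∈ {1,…,b}:
-- with m = δ·b, e = ⌊m/b⌋ + 1 and f = b·e - m = b - (m mod b).
scaled : ℕ → ℚ → ℤ      -- m = δ · b  (b a multiple of the denominator)
scaled b δ = ↥ δ ℤ.* (+ (b ℕ./ ↧ₙ δ))

reprE : ℕ → ℚ → ℤ
reprE zero      δ = + 0
reprE b@(suc _) δ = (scaled b δ /ℕ b) ℤ.+ + 1

reprF : ℕ → ℚ → ℕ
reprF zero      δ = 0
reprF b@(suc _) δ = b ∸ (scaled b δ %ℕ b)

Nδ : ℕ → ℚ → ℕ
Nδ b δ with reprE b δ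
... | + zero      = 0 ⊔ ceilDiv 0 (reprF b δ)
... | + suc e-1     = let e = suc e-1 in e ⊔ ceilDiv (b ℕ.* e) (b ∸ reprF b δ)
... | -[1+ n ]    = let e' = suc n in e' ⊔ ceilDiv (b ℕ.* e') (reprF b δ)

Nr : List ℚ → ℕ
Nr xs = lcd xs ℕ.* sum (map (Nδ (lcd xs)) xs) ℕ.+ 1

≡1mod : ℕ → ℕ → Set
≡1mod p b = b ∣ (p ∸ 1)

Prec-r : List ℚ → ℚ → ℚ → Set
Prec-r xs γ γ' = ∀ p → Prime p → ≡1mod p (lcd xs) → Nr xs < p → remP p γ < remP p γ'

{-# OPTIONS --safe #-}
module Submission where

-- Write b·δ = b·e − F with 1 ≤ F ≤ b (e = reprE, F = reprF). If p = 1 + k·b is prime and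
-- k > Σ N_δ ≥ Σ |e|, then rem_p(δ) = e + F·k: indeed (e + F·k)·b − b·δ = F·p, and
-- 0 ≤ e + F·k < p, the case F = b, e > 0 being excluded since δ would lie in ℤ_{≥0}.
-- Hence rem_p(γ') − rem_p(γ) = (e' − e) + (F' − F)·k is affine in k, while γ − γ' ∈ ℤ
-- iff F = F'. Going from p to q increases k, so the gap grows iff F < F'; and F > F' is
-- impossible when rem_p(γ) < rem_p(γ'), as then (F − F')·k ≥ k > |e| + |e'| ≥ e' − e.

open import Defs
open import Data.Nat using (ℕ; _<_)
open import Data.Nat.Primality using (Prime)
open import Data.Integer as ℤ using (+_)
open import Data.Rational as ℚ using (ℚ)
open import Data.Fin using (Fin)
open import Data.Vec using (Vec; lookup)
open import Data.List.Membership.Propositional using (_∈_)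
open import Function.Bundles using (_⇔_)
open import Relation.Nullary using (¬_)

open import Data.Nat as ℕ using (zero; suc; NonZero; _⊔_)
import Data.Nat.Properties as ℕP
open import Data.Nat.DivMod using (m*[n/m]≡n)
open import Data.Nat.Divisibility using (_∣_; divides; >⇒∤; n∣m⇒m%n≡0; ∣-trans; m/n∣m)
open import Data.Nat.LCM using (m∣lcm[m,n]; n∣lcm[m,n])
open import Data.Nat.ListAction using (sum)
open import Data.Nat.Primality using (euclidsLemma; ¬prime[0]; ¬prime[1])
open import Data.Integer as ℤ using (-[1+_]; ∣_∣; _⊖_)
import Data.Integer.Properties as ℤP
open import Data.Integer.DivMod using (_%ℕ_; _/ℕ_; a≡a%ℕn+[a/ℕn]*n; n%ℕd<d)
open import Data.Integer.Divisibility.Signed using (divides; ∣ᵤ⇒∣; ∣⇒∣ᵤ; ∣m∣n⇒∣m-n)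
  renaming (_∣_ to _∣ℤ_)
open import Data.Integer.Tactic.RingSolver using (solve-∀)
import Data.Rational.Properties as ℚP
open import Data.Rational.Unnormalised as ℚᵘ using (mkℚᵘ; *≡*) renaming (_≃_ to _≃ᵘ_)
import Data.Rational.Unnormalised.Properties as ℚᵘP
open import Data.List using (List; _∷_; filter; upTo; map)
open import Data.List.Membership.Propositional.Properties using (∈-upTo⁺; ∈-upTo⁻; ∈-++⁻)
open import Data.List.Relation.Unary.Any using (here; there)
open import Data.Vec using (toList)
open import Data.Vec.Membership.Propositional.Properties using (∈-toList⁻)
open import Data.Vec.Relation.Unary.Any.Properties using (lookup-index)
open import Data.Product using (∃; _×_; _,_)
open import Data.Sum as Sum using (_⊎_; inj₁; inj₂; [_,_]′)
open import Function.Base using (_∘_)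
open import Function.Bundles using (mk⇔; Equivalence)
open import Function.Construct.Composition using (_⇔-∘_)
open import Relation.Nullary using (yes; no; contradiction)
open import Relation.Unary using (Pred; Decidable)
open import Relation.Binary.PropositionalEquality

prime∣*⇒∣⊎∣ : ∀ {p} → Prime p → ∀ i j → + p ∣ℤ i ℤ.* j → + p ∣ℤ i ⊎ + p ∣ℤ j
prime∣*⇒∣⊎∣ {p} pp i j p∣ij =
  Sum.map ∣ᵤ⇒∣ ∣ᵤ⇒∣ (euclidsLemma ∣ i ∣ ∣ j ∣ pp (subst (p ∣_) (ℤP.abs-* i j) (∣⇒∣ᵤ p∣ij)))

∣∧<⇒≡0 : ∀ {k n} → k ∣ n → n ℕ.< k → n ≡ 0
∣∧<⇒≡0 {n = zero}  _   _   = refl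
∣∧<⇒≡0 {n = suc _} k∣n n<k = contradiction k∣n (>⇒∤ n<k)

∣[m-n]∧<⇒≡ : ∀ {k m n} → m ℕ.< k → n ℕ.< k → + k ∣ℤ (+ m ℤ.- + n) → m ≡ n
∣[m-n]∧<⇒≡ {k} {m} {n} m<k n<k k∣m-n =
  ℤP.+-injective (ℤP.i-j≡0⇒i≡j (+ m) (+ n) (ℤP.∣i∣≡0⇒i≡0 (∣∧<⇒≡0 (∣⇒∣ᵤ k∣m-n) ∣m-n∣<k)))
  where
  open ℕP.≤-Reasoning
  ∣m-n∣<k : ∣ + m ℤ.- + n ∣ ℕ.< k
  ∣m-n∣<k = begin-strict
    ∣ + m ℤ.- + n ∣ ≡⟨ cong ∣_∣ (ℤP.m-n≡m⊖n m n) ⟩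
    ∣ m ⊖ n ∣       ≤⟨ ℤP.∣m⊝n∣≤m⊔n m n ⟩
    m ⊔ n           <⟨ ℕP.⊔-lub m<k n<k ⟩
    k               ∎

%ℕ≡0⇒∣ : ∀ i k .{{_ : NonZero k}} → i %ℕ k ≡ 0 → + k ∣ℤ i
%ℕ≡0⇒∣ i k i%k≡0 = divides (i /ℕ k) (begin
  i                                ≡⟨ a≡a%ℕn+[a/ℕn]*n i k ⟩
  + (i %ℕ k) ℤ.+ (i /ℕ k) ℤ.* + k  ≡⟨ cong (λ r → + r ℤ.+ (i /ℕ k) ℤ.* + k) i%k≡0 ⟩
  + 0 ℤ.+ (i /ℕ k) ℤ.* + k         ≡⟨ ℤP.+-identityˡ _ ⟩
  (i /ℕ k) ℤ.* + k                 ∎)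
  where open ≡-Reasoning

∣⇒%ℕ≡0 : ∀ i k .{{_ : NonZero k}} → + k ∣ℤ i → i %ℕ k ≡ 0
∣⇒%ℕ≡0 (+ n)    k k∣i = n∣m⇒m%n≡0 n k (∣⇒∣ᵤ k∣i)
∣⇒%ℕ≡0 -[1+ n ] k k∣i with suc n ℕ.% k | n∣m⇒m%n≡0 (suc n) k (∣⇒∣ᵤ k∣i)
... | .zero | refl = refl

∣[i-j]⇔%ℕ≡ : ∀ i j k .{{_ : NonZero k}} → + k ∣ℤ i ℤ.- j ⇔ i %ℕ k ≡ j %ℕ k
∣[i-j]⇔%ℕ≡ i j k = mk⇔ to from
  where
  open ≡-Reasoning
  r = + (i %ℕ k) ; s = + (j %ℕ k) ; q = i /ℕ k ; q' = j /ℕ k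
  i-j≡ : i ℤ.- j ≡ (r ℤ.+ q ℤ.* + k) ℤ.- (s ℤ.+ q' ℤ.* + k)
  i-j≡ = cong₂ ℤ._-_ (a≡a%ℕn+[a/ℕn]*n i k) (a≡a%ℕn+[a/ℕn]*n j k)
  to : + k ∣ℤ i ℤ.- j → i %ℕ k ≡ j %ℕ k
  to (divides z i-j≡z*k) = ∣[m-n]∧<⇒≡ (n%ℕd<d i k) (n%ℕd<d j k) (divides (z ℤ.- q ℤ.+ q') (begin
    r ℤ.- s                                        ≡⟨ shift r s q q' (+ k) ⟩
    (r ℤ.+ q ℤ.* + k) ℤ.- (s ℤ.+ q' ℤ.* + k) ℤ.- (q ℤ.- q') ℤ.* + k  ≡⟨ cong (λ t → t ℤ.- (q ℤ.- q') ℤ.* + k) (sym i-j≡) ⟩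
    (i ℤ.- j) ℤ.- (q ℤ.- q') ℤ.* + k               ≡⟨ cong (λ t → t ℤ.- (q ℤ.- q') ℤ.* + k) i-j≡z*k ⟩
    z ℤ.* + k ℤ.- (q ℤ.- q') ℤ.* + k               ≡⟨ collect z q q' (+ k) ⟩
    (z ℤ.- q ℤ.+ q') ℤ.* + k                       ∎))
    where
    shift : ∀ r s q q' k → r ℤ.- s ≡ (r ℤ.+ q ℤ.* k) ℤ.- (s ℤ.+ q' ℤ.* k) ℤ.- (q ℤ.- q') ℤ.* k
    shift = solve-∀
    collect : ∀ z q q' k → z ℤ.* k ℤ.- (q ℤ.- q') ℤ.* k ≡ (z ℤ.- q ℤ.+ q') ℤ.* k
    collect = solve-∀
  from : i %ℕ k ≡ j %ℕ k → + k ∣ℤ i ℤ.- j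
  from r≡s = divides (q ℤ.- q') (begin
    i ℤ.- j                                    ≡⟨ i-j≡ ⟩
    (r ℤ.+ q ℤ.* + k) ℤ.- (s ℤ.+ q' ℤ.* + k)   ≡⟨ cong (λ t → (+ t ℤ.+ q ℤ.* + k) ℤ.- (s ℤ.+ q' ℤ.* + k)) r≡s ⟩
    (s ℤ.+ q ℤ.* + k) ℤ.- (s ℤ.+ q' ℤ.* + k)   ≡⟨ cancel s q q' (+ k) ⟩
    (q ℤ.- q') ℤ.* + k                         ∎)
    where
    cancel : ∀ s q q' k → (s ℤ.+ q ℤ.* k) ℤ.- (s ℤ.+ q' ℤ.* k) ≡ (q ℤ.- q') ℤ.* k
    cancel = solve-∀

filter-unique : ∀ {a ℓ} {A : Set a} {P : Pred A ℓ} (P? : Decidable P) {xs v} →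
                v ∈ xs → P v → (∀ {y} → y ∈ xs → P y → y ≡ v) →
                ∃ λ ys → filter P? xs ≡ v ∷ ys
filter-unique P? {x ∷ xs} v∈ Pv unique with P? x
... | yes Px rewrite unique (here refl) Px = filter P? xs , refl
filter-unique P? {x ∷ xs} (here refl) Pv unique | no ¬Px = contradiction Pv ¬Px
filter-unique P? {x ∷ xs} (there v∈) Pv unique | no ¬Px =
  filter-unique P? v∈ Pv (λ y∈ → unique (there y∈))

prime∣[r*d-n]-unique : ∀ {p r s d} n → Prime p → ¬ p ∣ d → r ℕ.< p → s ℕ.< p →
                       + p ∣ℤ + r ℤ.* + d ℤ.- n → + p ∣ℤ + s ℤ.* + d ℤ.- n → r ≡ s
prime∣[r*d-n]-unique {p} {r} {s} {d} n pp p∤d r<p s<p p∣r p∣s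
  with prime∣*⇒∣⊎∣ pp (+ r ℤ.- + s) (+ d) (subst (+ p ∣ℤ_) (difference (+ r) (+ s) (+ d) n) (∣m∣n⇒∣m-n p∣r p∣s))
  where
  difference : ∀ r s d n → (r ℤ.* d ℤ.- n) ℤ.- (s ℤ.* d ℤ.- n) ≡ (r ℤ.- s) ℤ.* d
  difference = solve-∀
... | inj₁ p∣r-s = ∣[m-n]∧<⇒≡ r<p s<p p∣r-s
... | inj₂ p∣d   = contradiction (∣⇒∣ᵤ p∣d) p∤d

remP-unique : ∀ {p x v} → Prime p → ¬ p ∣ ℚ.↧ₙ x → v ℕ.< p →
              + p ∣ℤ + v ℤ.* ℚ.↧ x ℤ.- ℚ.↥ x → remP p x ≡ v
remP-unique {suc p-1} {x} {v} pp p∤d v<p p∣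
  with filter (λ r → ((+ r ℤ.* ℚ.↧ x ℤ.- ℚ.↥ x) %ℕ suc p-1) ℕ.≟ 0) (upTo (suc p-1))
     | filter-unique (λ r → ((+ r ℤ.* ℚ.↧ x ℤ.- ℚ.↥ x) %ℕ suc p-1) ℕ.≟ 0)
         (∈-upTo⁺ v<p) (∣⇒%ℕ≡0 _ _ p∣)
         (λ y∈ r%p≡0 → prime∣[r*d-n]-unique (ℚ.↥ x) pp p∤d (∈-upTo⁻ y∈) v<p (%ℕ≡0⇒∣ _ _ r%p≡0) p∣)
... | .(v ∷ ys) | ys , refl = refl

e+F*k∈[0,b*k] : ∀ e F b k → 1 ℕ.≤ F → F ℕ.≤ b → ∣ e ∣ ℕ.< k → (F ≡ b → e ℤ.≤ + 0) →
               ∃ λ v → + v ≡ e ℤ.+ + (F ℕ.* k) × v ℕ.≤ b ℕ.* k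
e+F*k∈[0,b*k] (+ zero) F b k _ F≤b _ _ = F ℕ.* k , refl , ℕP.*-monoˡ-≤ k F≤b
e+F*k∈[0,b*k] (+ suc n) F b k _ F≤b e<k e≤0 = suc n ℕ.+ F ℕ.* k , refl , (begin
  suc n ℕ.+ F ℕ.* k ≤⟨ ℕP.+-monoˡ-≤ (F ℕ.* k) (ℕP.<⇒≤ e<k) ⟩
  suc F ℕ.* k       ≤⟨ ℕP.*-monoˡ-≤ k F<b ⟩
  b ℕ.* k           ∎)
  where
  open ℕP.≤-Reasoning
  F<b : F ℕ.< b
  F<b = ℕP.≤∧≢⇒< F≤b (λ F≡b → contradiction (e≤0 F≡b) λ { (ℤ.+≤+ ()) })
e+F*k∈[0,b*k] -[1+ n ] F b k 1≤F F≤b e<k _ =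
  F ℕ.* k ℕ.∸ suc n , sym (ℤP.⊖-≥ n<F*k) ,
  ℕP.≤-trans (ℕP.m∸n≤m (F ℕ.* k) (suc n)) (ℕP.*-monoˡ-≤ k F≤b)
  where
  n<F*k : suc n ℕ.≤ F ℕ.* k
  n<F*k = ℕP.≤-trans (ℕP.<⇒≤ e<k) (ℕP.≤-trans (ℕP.m≤m+n k _) (ℕP.*-monoˡ-≤ k 1≤F))

module _ {b-1 : ℕ} where
  private
    b = suc b-1

  ↧*[b/↧ₙ]≡b : ∀ δ → ℚ.↧ₙ δ ∣ b → ℚ.↧ δ ℤ.* + (b ℕ./ ℚ.↧ₙ δ) ≡ + b
  ↧*[b/↧ₙ]≡b δ ↧∣b = trans (sym (ℤP.pos-* (ℚ.↧ₙ δ) _)) (cong +_ (m*[n/m]≡n ↧∣b))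

  toℚᵘ≃scaled : ∀ δ → ℚ.↧ₙ δ ∣ b → ℚ.toℚᵘ δ ≃ᵘ mkℚᵘ (scaled b δ) b-1
  toℚᵘ≃scaled δ@record{} ↧∣b = *≡* (begin
    ℚ.↥ δ ℤ.* + b                          ≡⟨ cong (ℚ.↥ δ ℤ.*_) (sym (↧*[b/↧ₙ]≡b δ ↧∣b)) ⟩
    ℚ.↥ δ ℤ.* (ℚ.↧ δ ℤ.* c)                ≡⟨ rearrange (ℚ.↥ δ) (ℚ.↧ δ) c ⟩
    ℚ.↥ δ ℤ.* c ℤ.* ℚ.↧ δ                  ∎)
    where
    open ≡-Reasoning
    c = + (b ℕ./ ℚ.↧ₙ δ)
    rearrange : ∀ n d c → n ℤ.* (d ℤ.* c) ≡ n ℤ.* c ℤ.* d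
    rearrange = solve-∀

  -- z ℚ./ 1 is definitionally fromℚᵘ (mkℚᵘ z 0).
  ≃[z*b]⇒≡z/1 : ∀ x z → ℚ.toℚᵘ x ≃ᵘ mkℚᵘ (z ℤ.* + b) b-1 → x ≡ z ℚ./ 1
  ≃[z*b]⇒≡z/1 x z x≃z*b = ℚP.toℚᵘ-injective (begin
    ℚ.toℚᵘ x             ≈⟨ x≃z*b ⟩
    mkℚᵘ (z ℤ.* + b) b-1 ≈⟨ *≡* (ℤP.*-identityʳ (z ℤ.* + b)) ⟩
    mkℚᵘ z 0             ≈⟨ ℚᵘP.≃-sym (ℚP.toℚᵘ-fromℚᵘ (mkℚᵘ z 0)) ⟩
    ℚ.toℚᵘ (z ℚ./ 1)     ∎)
    where open ℚᵘP.≃-Reasoning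

  IsInt⇔b∣ : ∀ x n → ℚ.toℚᵘ x ≃ᵘ mkℚᵘ n b-1 → IsInt x ⇔ + b ∣ℤ n
  IsInt⇔b∣ x n x≃n/b = mk⇔ to from
    where
    to : IsInt x → + b ∣ℤ n
    to (z , refl) with ℚᵘP.≃-trans (ℚᵘP.≃-sym x≃n/b) (ℚP.toℚᵘ-fromℚᵘ (mkℚᵘ z 0))
    ... | *≡* n*1≡z*b = divides z (trans (sym (ℤP.*-identityʳ n)) n*1≡z*b)
    from : + b ∣ℤ n → IsInt x
    from (divides z refl) = z , ≃[z*b]⇒≡z/1 x z x≃n/b

  toℚᵘ[x-y]≃ : ∀ x y m n → ℚ.toℚᵘ x ≃ᵘ mkℚᵘ m b-1 → ℚ.toℚᵘ y ≃ᵘ mkℚᵘ n b-1 →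
               ℚ.toℚᵘ (x ℚ.- y) ≃ᵘ mkℚᵘ (m ℤ.- n) b-1
  toℚᵘ[x-y]≃ x y m n x≃m/b y≃n/b = begin
    ℚ.toℚᵘ (x ℚ.- y)                       ≈⟨ ℚP.toℚᵘ-homo-+ x (ℚ.- y) ⟩
    ℚ.toℚᵘ x ℚᵘ.+ ℚ.toℚᵘ (ℚ.- y)           ≈⟨ ℚᵘP.+-congʳ (ℚ.toℚᵘ x) (ℚP.toℚᵘ-homo‿- y) ⟩
    ℚ.toℚᵘ x ℚᵘ.- ℚ.toℚᵘ y                 ≈⟨ ℚᵘP.+-cong x≃m/b (ℚᵘP.-‿cong y≃n/b) ⟩
    mkℚᵘ m b-1 ℚᵘ.- mkℚᵘ n b-1             ≈⟨ *≡* common-denominator ⟩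
    mkℚᵘ (m ℤ.- n) b-1                     ∎
    where
    open ℚᵘP.≃-Reasoning
    common-denominator : (m ℤ.* + b ℤ.+ ℤ.- n ℤ.* + b) ℤ.* + b ≡ (m ℤ.- n) ℤ.* + (b ℕ.* b)
    common-denominator = trans (factor m n (+ b)) (cong ((m ℤ.- n) ℤ.*_) (ℤP.pos-* b b))
      where
      factor : ∀ m n b → (m ℤ.* b ℤ.+ ℤ.- n ℤ.* b) ℤ.* b ≡ (m ℤ.- n) ℤ.* (b ℤ.* b)
      factor = solve-∀

  IsInt[γ-γ']⇔reprF≡ : ∀ γ γ' → ℚ.↧ₙ γ ∣ b → ℚ.↧ₙ γ' ∣ b →
                       IsInt (γ ℚ.- γ') ⇔ reprF b γ ≡ reprF b γ'
  IsInt[γ-γ']⇔reprF≡ γ γ' ↧∣b ↧'∣b =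
    b∸-injective ⇔-∘ (∣[i-j]⇔%ℕ≡ m m' b ⇔-∘ IsInt⇔b∣ (γ ℚ.- γ') (m ℤ.- m')
      (toℚᵘ[x-y]≃ γ γ' m m' (toℚᵘ≃scaled γ ↧∣b) (toℚᵘ≃scaled γ' ↧'∣b)))
    where
    m = scaled b γ ; m' = scaled b γ'
    b∸-injective : m %ℕ b ≡ m' %ℕ b ⇔ b ℕ.∸ m %ℕ b ≡ b ℕ.∸ m' %ℕ b
    b∸-injective = mk⇔ (cong (b ℕ.∸_))
      (ℕP.∸-cancelˡ-≡ (ℕP.<⇒≤ (n%ℕd<d m b)) (ℕP.<⇒≤ (n%ℕd<d m' b)))

  scaled≡b*reprE-reprF : ∀ δ → scaled b δ ≡ + b ℤ.* reprE b δ ℤ.- + reprF b δ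
  scaled≡b*reprE-reprF δ = begin
    m                                   ≡⟨ a≡a%ℕn+[a/ℕn]*n m b ⟩
    + s ℤ.+ q ℤ.* + b                   ≡⟨ regroup (+ s) q (+ b) ⟩
    + b ℤ.* (q ℤ.+ + 1) ℤ.- (+ b ℤ.- + s) ≡⟨ cong (λ t → + b ℤ.* (q ℤ.+ + 1) ℤ.- t) b-s≡b∸s ⟩
    + b ℤ.* (q ℤ.+ + 1) ℤ.- + (b ℕ.∸ s) ∎
    where
    open ≡-Reasoning
    m = scaled b δ ; s = m %ℕ b ; q = m /ℕ b
    regroup : ∀ s q b → s ℤ.+ q ℤ.* b ≡ b ℤ.* (q ℤ.+ + 1) ℤ.- (b ℤ.- s)
    regroup = solve-∀
    b-s≡b∸s : + b ℤ.- + s ≡ + (b ℕ.∸ s)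
    b-s≡b∸s = trans (ℤP.m-n≡m⊖n b s) (ℤP.⊖-≥ (ℕP.<⇒≤ (n%ℕd<d m b)))

  1≤reprF : ∀ δ → 1 ℕ.≤ reprF b δ
  1≤reprF δ = ℕP.m<n⇒0<n∸m (n%ℕd<d (scaled b δ) b)

  reprF≤b : ∀ δ → reprF b δ ℕ.≤ b
  reprF≤b δ = ℕP.m∸n≤m b (scaled b δ %ℕ b)

  reprF≡b⇒reprE≤0 : ∀ δ → ℚ.↧ₙ δ ∣ b → ¬ NonNegInt δ → reprF b δ ≡ b → reprE b δ ℤ.≤ + 0
  reprF≡b⇒reprE≤0 δ ↧∣b ¬nni F≡b = nonPositive q (≃[z*b]⇒≡z/1 δ q δ≃q*b)
    where
    m = scaled b δ ; s = m %ℕ b ; q = m /ℕ b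
    s≡0 : s ≡ 0
    s≡0 = ℕP.∸-cancelˡ-≡ (ℕP.<⇒≤ (n%ℕd<d m b)) ℕ.z≤n F≡b
    δ≃q*b : ℚ.toℚᵘ δ ≃ᵘ mkℚᵘ (q ℤ.* + b) b-1
    δ≃q*b = subst (λ t → ℚ.toℚᵘ δ ≃ᵘ mkℚᵘ t b-1)
      (trans (a≡a%ℕn+[a/ℕn]*n m b) (trans (cong (λ r → + r ℤ.+ q ℤ.* + b) s≡0) (ℤP.+-identityˡ _)))
      (toℚᵘ≃scaled δ ↧∣b)
    nonPositive : ∀ z → δ ≡ z ℚ./ 1 → z ℤ.+ + 1 ℤ.≤ + 0
    nonPositive (+ n)         δ≡n/1 = contradiction (n , δ≡n/1) ¬nni
    nonPositive -[1+ zero ]   _     = ℤ.+≤+ ℕ.z≤n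
    nonPositive -[1+ suc n ]  _     = ℤ.-≤+

  remP-unique-scaled : ∀ {p v} δ → Prime p → ¬ p ∣ b → ℚ.↧ₙ δ ∣ b → v ℕ.< p →
                       + p ∣ℤ + v ℤ.* + b ℤ.- scaled b δ → remP p δ ≡ v
  remP-unique-scaled {p} {v} δ pp p∤b ↧∣b v<p p∣vb-m
    with prime∣*⇒∣⊎∣ pp c (+ v ℤ.* ℚ.↧ δ ℤ.- ℚ.↥ δ) (subst (+ p ∣ℤ_) factor p∣vb-m)
    where
    c = + (b ℕ./ ℚ.↧ₙ δ)
    factor : + v ℤ.* + b ℤ.- scaled b δ ≡ c ℤ.* (+ v ℤ.* ℚ.↧ δ ℤ.- ℚ.↥ δ)
    factor = trans (cong (λ t → + v ℤ.* t ℤ.- scaled b δ) (sym (↧*[b/↧ₙ]≡b δ ↧∣b)))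
                   (pull-out (+ v) (ℚ.↧ δ) (ℚ.↥ δ) c)
      where
      pull-out : ∀ v d n c → v ℤ.* (d ℤ.* c) ℤ.- n ℤ.* c ≡ c ℤ.* (v ℤ.* d ℤ.- n)
      pull-out = solve-∀
  ... | inj₁ p∣c = contradiction (∣-trans (∣⇒∣ᵤ p∣c) (m/n∣m ↧∣b)) p∤b
  ... | inj₂ p∣vd-n = remP-unique pp (λ p∣d → p∤b (∣-trans p∣d ↧∣b)) v<p p∣vd-n

  remP≡reprE+reprF*k : ∀ {p k} δ → Prime p → p ≡ suc (k ℕ.* b) → ℚ.↧ₙ δ ∣ b →
                       ¬ NonNegInt δ → ∣ reprE b δ ∣ ℕ.< k →
                       + remP p δ ≡ reprE b δ ℤ.+ + reprF b δ ℤ.* + k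
  remP≡reprE+reprF*k {p} {k} δ pp p≡1+kb ↧∣b ¬nni e<k =
    value (e+F*k∈[0,b*k] e F b k (1≤reprF δ) (reprF≤b δ) e<k (reprF≡b⇒reprE≤0 δ ↧∣b ¬nni))
    where
    open ≡-Reasoning
    e = reprE b δ ; F = reprF b δ
    p∤b : ¬ p ∣ b
    p∤b = >⇒∤ (subst (b ℕ.<_) (sym p≡1+kb) (ℕ.s≤s (ℕP.m≤n*m b k {{ℕ.>-nonZero (ℕP.≤-<-trans ℕ.z≤n e<k)}})))
    value : ∃ (λ v → + v ≡ e ℤ.+ + (F ℕ.* k) × v ℕ.≤ b ℕ.* k) → + remP p δ ≡ e ℤ.+ + F ℤ.* + k
    value (v , v≡e+Fk , v≤bk) = begin
      + remP p δ          ≡⟨ cong +_ (remP-unique-scaled δ pp p∤b ↧∣b v<p (divides (+ F) v*b-m≡F*p)) ⟩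
      + v                 ≡⟨ v≡e+Fk ⟩
      e ℤ.+ + (F ℕ.* k)   ≡⟨ cong (λ x → e ℤ.+ x) (ℤP.pos-* F k) ⟩
      e ℤ.+ + F ℤ.* + k   ∎
      where
      v<p : v ℕ.< p
      v<p = subst (v ℕ.<_) (sym p≡1+kb) (ℕ.s≤s (subst (v ℕ.≤_) (ℕP.*-comm b k) v≤bk))
      v*b-m≡F*p : + v ℤ.* + b ℤ.- scaled b δ ≡ + F ℤ.* + p
      v*b-m≡F*p = begin
        + v ℤ.* + b ℤ.- scaled b δ                           ≡⟨ cong₂ (λ x y → x ℤ.* + b ℤ.- y) v≡e+Fk (scaled≡b*reprE-reprF δ) ⟩
        (e ℤ.+ + (F ℕ.* k)) ℤ.* + b ℤ.- (+ b ℤ.* e ℤ.- + F)  ≡⟨ cong (λ x → (e ℤ.+ x) ℤ.* + b ℤ.- (+ b ℤ.* e ℤ.- + F)) (ℤP.pos-* F k) ⟩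
        (e ℤ.+ + F ℤ.* + k) ℤ.* + b ℤ.- (+ b ℤ.* e ℤ.- + F)  ≡⟨ regroup e (+ F) (+ k) (+ b) ⟩
        + F ℤ.* (+ 1 ℤ.+ + k ℤ.* + b)                        ≡⟨ cong (λ x → + F ℤ.* (+ 1 ℤ.+ x)) (sym (ℤP.pos-* k b)) ⟩
        + F ℤ.* + suc (k ℕ.* b)                              ≡⟨ cong (λ x → + F ℤ.* + x) (sym p≡1+kb) ⟩
        + F ℤ.* + p                                          ∎
        where
        regroup : ∀ e F k b → (e ℤ.+ F ℤ.* k) ℤ.* b ℤ.- (b ℤ.* e ℤ.- F) ≡ F ℤ.* (+ 1 ℤ.+ k ℤ.* b)
        regroup = solve-∀

affine-gap : ∀ e e' F F' k → (e' ℤ.+ F' ℤ.* k) ℤ.- (e ℤ.+ F ℤ.* k) ≡ (e' ℤ.- e) ℤ.+ (F' ℤ.- F) ℤ.* k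
affine-gap = solve-∀

0<j-i⇔i<j : ∀ i j → + 0 ℤ.< j ℤ.- i ⇔ i ℤ.< j
0<j-i⇔i<j i j = mk⇔
  (λ 0<j-i → subst₂ ℤ._<_ (ℤP.+-identityˡ i) (cancel i j) (ℤP.+-monoˡ-< i 0<j-i))
  (λ i<j → subst (ℤ._< j ℤ.- i) (ℤP.+-inverseʳ i) (ℤP.+-monoˡ-< (ℤ.- i) i<j))
  where
  cancel : ∀ i j → j ℤ.- i ℤ.+ i ≡ j
  cancel = solve-∀

+*-<⇔0< : ∀ c a {k k'} → k ℤ.< k' → c ℤ.+ a ℤ.* k ℤ.< c ℤ.+ a ℤ.* k' ⇔ + 0 ℤ.< a
+*-<⇔0< c a {k} {k'} k<k' = mk⇔ to from
  where
  from : + 0 ℤ.< a → c ℤ.+ a ℤ.* k ℤ.< c ℤ.+ a ℤ.* k'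
  from 0<a = ℤP.+-monoʳ-< c (ℤP.*-monoˡ-<-pos a {{ℤ.positive 0<a}} k<k')
  to : c ℤ.+ a ℤ.* k ℤ.< c ℤ.+ a ℤ.* k' → + 0 ℤ.< a
  to ak<ak' with + 0 ℤ.<? a
  ... | yes 0<a = 0<a
  ... | no  0≮a = contradiction ak<ak'
    (ℤP.≤⇒≯ (ℤP.+-monoʳ-≤ c (ℤP.*-monoˡ-≤-nonPos a {{ℤ.nonPositive (ℤP.≮⇒≥ 0≮a)}} (ℤP.<⇒≤ k<k'))))

affine-gap-<⇔ : ∀ e e' F F' {k k'} → k ℤ.< k' →
  (e' ℤ.+ F' ℤ.* k) ℤ.- (e ℤ.+ F ℤ.* k) ℤ.< (e' ℤ.+ F' ℤ.* k') ℤ.- (e ℤ.+ F ℤ.* k') ⇔ F ℤ.< F'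
affine-gap-<⇔ e e' F F' {k} {k'} k<k' rewrite affine-gap e e' F F' k | affine-gap e e' F F' k' =
  0<j-i⇔i<j F F' ⇔-∘ +*-<⇔0< (e' ℤ.- e) (F' ℤ.- F) k<k'

affine-<⇒slope-≤ : ∀ e e' F F' k → ∣ e ∣ ℕ.+ ∣ e' ∣ ℕ.< k →
                   e ℤ.+ F ℤ.* + k ℤ.< e' ℤ.+ F' ℤ.* + k → F ℤ.≤ F'
affine-<⇒slope-≤ e e' F F' k small lt with F ℤ.≤? F'
... | yes F≤F' = F≤F'
... | no  F≰F' = contradiction (begin-strict
  e' ℤ.+ F' ℤ.* + k                ≡⟨ split e e' (F' ℤ.* + k) ⟩
  e ℤ.+ ((e' ℤ.- e) ℤ.+ F' ℤ.* + k) <⟨ ℤP.+-monoʳ-< e (ℤP.+-monoˡ-< (F' ℤ.* + k) e'-e<k) ⟩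
  e ℤ.+ (+ k ℤ.+ F' ℤ.* + k)        ≡⟨ cong (λ x → e ℤ.+ x) (sym (ℤP.suc-* F' (+ k))) ⟩
  e ℤ.+ ℤ.suc F' ℤ.* + k            ≤⟨ ℤP.+-monoʳ-≤ e (ℤP.*-monoʳ-≤-nonNeg (+ k) (ℤP.i<j⇒suc[i]≤j (ℤP.≰⇒> F≰F'))) ⟩
  e ℤ.+ F ℤ.* + k                   <⟨ lt ⟩
  e' ℤ.+ F' ℤ.* + k                 ∎) (ℤP.<-irrefl refl)
  where
  open ℤP.≤-Reasoning
  split : ∀ e e' x → e' ℤ.+ x ≡ e ℤ.+ ((e' ℤ.- e) ℤ.+ x)
  split = solve-∀
  e'-e<k : e' ℤ.- e ℤ.< + k
  e'-e<k = ℤP.≤-<-trans (i≤+∣i∣ (e' ℤ.- e)) (ℤ.+<+ (ℕP.≤-<-trans (ℤP.∣i-j∣≤∣i∣+∣j∣ e' e)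
             (subst (ℕ._< k) (ℕP.+-comm ∣ e ∣ ∣ e' ∣) small)))
    where
    i≤+∣i∣ : ∀ i → i ℤ.≤ + ∣ i ∣
    i≤+∣i∣ (+ _)    = ℤP.≤-refl
    i≤+∣i∣ -[1+ _ ] = ℤ.-≤+

gap-criterion : ∀ {P : Set} e e' F F' {kp kq} → P ⇔ F ≡ F' → kp ℕ.< kq →
                (F ≢ F' → ∣ e ∣ ℕ.+ ∣ e' ∣ ℕ.< kp) →
                e ℤ.+ + F ℤ.* + kp ℤ.< e' ℤ.+ + F' ℤ.* + kp →
                (¬ P) ⇔ ((e' ℤ.+ + F' ℤ.* + kp) ℤ.- (e ℤ.+ + F ℤ.* + kp)
                         ℤ.< (e' ℤ.+ + F' ℤ.* + kq) ℤ.- (e ℤ.+ + F ℤ.* + kq))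
gap-criterion e e' F F' {kp} P⇔F≡F' kp<kq small ordered = mk⇔
  (λ ¬P → let F≢F' = ¬P ∘ Equivalence.from P⇔F≡F' in
    Equivalence.from gap-<⇔ (ℤ.+<+ (ℕP.≤∧≢⇒< (ℤP.drop‿+≤+
      (affine-<⇒slope-≤ e e' (+ F) (+ F') kp (small F≢F') ordered)) F≢F')))
  (λ gap-< P → ℤP.<⇒≢ (Equivalence.to gap-<⇔ gap-<) (cong +_ (Equivalence.to P⇔F≡F' P)))
  where
  gap-<⇔ = affine-gap-<⇔ e e' (+ F) (+ F') (ℤ.+<+ kp<kq)

∈⇒≤sum : ∀ {a} {A : Set a} (f : A → ℕ) {x xs} → x ∈ xs → f x ℕ.≤ sum (map f xs)
∈⇒≤sum f {xs = y ∷ ys} (here refl) = ℕP.m≤m+n (f y) _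
∈⇒≤sum f {xs = y ∷ ys} (there x∈) = ℕP.≤-trans (∈⇒≤sum f x∈) (ℕP.m≤n+m _ (f y))

∈∧∈∧≢⇒+≤sum : ∀ {a} {A : Set a} (f : A → ℕ) {x y xs} → x ∈ xs → y ∈ xs → x ≢ y →
              f x ℕ.+ f y ℕ.≤ sum (map f xs)
∈∧∈∧≢⇒+≤sum f (here refl) (here refl) x≢y = contradiction refl x≢y
∈∧∈∧≢⇒+≤sum f {xs = z ∷ zs} (here refl) (there y∈) _ = ℕP.+-monoʳ-≤ (f z) (∈⇒≤sum f y∈)
∈∧∈∧≢⇒+≤sum f {x} {xs = z ∷ zs} (there x∈) (here refl) _ =
  subst (ℕ._≤ f z ℕ.+ sum (map f zs)) (ℕP.+-comm (f z) (f x)) (ℕP.+-monoʳ-≤ (f z) (∈⇒≤sum f x∈))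
∈∧∈∧≢⇒+≤sum f {xs = z ∷ zs} (there x∈) (there y∈) x≢y =
  ℕP.≤-trans (∈∧∈∧≢⇒+≤sum f x∈ y∈ x≢y) (ℕP.m≤n+m _ (f z))

∈⇒↧ₙ∣lcd : ∀ xs {x} → x ∈ xs → ℚ.↧ₙ x ∣ lcd xs
∈⇒↧ₙ∣lcd (y ∷ ys) (here refl) = m∣lcm[m,n] (ℚ.↧ₙ y) (lcd ys)
∈⇒↧ₙ∣lcd (y ∷ ys) (there x∈)  = ∣-trans (∈⇒↧ₙ∣lcd ys x∈) (n∣lcm[m,n] (ℚ.↧ₙ y) (lcd ys))

∀lookup⇒∀∈toList : ∀ {a ℓ} {A : Set a} {P : Pred A ℓ} {n} (v : Vec A n) →
                   (∀ i → P (lookup v i)) → ∀ {x} → x ∈ toList v → P x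
∀lookup⇒∀∈toList {P = P} v P-lookup x∈ = subst P (sym (lookup-index (∈-toList⁻ x∈))) (P-lookup _)

∣reprE∣≤Nδ : ∀ b δ → ∣ reprE b δ ∣ ℕ.≤ Nδ b δ
∣reprE∣≤Nδ b δ with reprE b δ
... | + zero    = ℕ.z≤n
... | + suc n   = ℕP.m≤m⊔n (suc n) (ceilDiv (b ℕ.* suc n) (b ℕ.∸ reprF b δ))
... | -[1+ n ]  = ℕP.m≤m⊔n (suc n) (ceilDiv (b ℕ.* suc n) (reprF b δ))

≡1mod⇒≡1+k*b : ∀ {p b} → Prime p → ≡1mod p b → ∃ λ k → p ≡ suc (k ℕ.* b)
≡1mod⇒≡1+k*b {zero}  pp _              = contradiction pp ¬prime[0]
≡1mod⇒≡1+k*b {suc _} _  (divides k eq) = k , cong suc eq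

remainder-gap-criterion :
  ∀ (L : List ℚ) b → (∀ {x} → x ∈ L → ℚ.↧ₙ x ∣ b) → (∀ {x} → x ∈ L → ¬ NonNegInt x) →
  ∀ {p q} → Prime p → Prime q → ≡1mod p b → ≡1mod q b →
  b ℕ.* sum (map (Nδ b) L) ℕ.+ 1 ℕ.< p → p ℕ.< q →
  ∀ {γ γ'} → γ ∈ L → γ' ∈ L → remP p γ ℕ.< remP p γ' →
  (¬ IsInt (γ ℚ.- γ')) ⇔ ((+ remP p γ' ℤ.- + remP p γ) ℤ.< (+ remP q γ' ℤ.- + remP q γ))
remainder-gap-criterion L b ↧∣b ¬nni pp pq p≡1 q≡1 N<p p<q γ∈ γ'∈ ordered
  with ≡1mod⇒≡1+k*b pp p≡1 | ≡1mod⇒≡1+k*b pq q≡1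
remainder-gap-criterion L zero _ _ pp _ _ _ _ _ _ _ _ | kp , p≡1+kp*0 | _ =
  contradiction (subst Prime (trans p≡1+kp*0 (cong suc (ℕP.*-zeroʳ kp))) pp) ¬prime[1]
remainder-gap-criterion L b@(suc _) ↧∣b ¬nni {p} {q} pp pq _ _ N<p p<q {γ} {γ'} γ∈ γ'∈ ordered
  | kp , p≡1+kp*b | kq , q≡1+kq*b =
  subst₂ (λ x y → (¬ IsInt (γ ℚ.- γ')) ⇔ x ℤ.< y) (sym (gap pp p≡1+kp*b S<kp)) (sym (gap pq q≡1+kq*b S<kq))
    (gap-criterion e e' F F' (IsInt[γ-γ']⇔reprF≡ γ γ' (↧∣b γ∈) (↧∣b γ'∈)) kp<kq small ordered-at-kp)
  where
  S = sum (map (Nδ b) L)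
  e = reprE b γ ; e' = reprE b γ' ; F = reprF b γ ; F' = reprF b γ'
  S<kp : S ℕ.< kp
  S<kp = ℕP.*-cancelˡ-< b S kp (subst (b ℕ.* S ℕ.<_) (ℕP.*-comm kp b)
           (ℕP.≤-pred (subst₂ ℕ._<_ (ℕP.+-comm (b ℕ.* S) 1) p≡1+kp*b N<p)))
  kp<kq : kp ℕ.< kq
  kp<kq = ℕP.*-cancelʳ-< b kp kq (ℕP.≤-pred (subst₂ ℕ._<_ p≡1+kp*b q≡1+kq*b p<q))
  S<kq : S ℕ.< kq
  S<kq = ℕP.<-trans S<kp kp<kq
  remainder : ∀ {r k} → Prime r → r ≡ suc (k ℕ.* b) → S ℕ.< k → ∀ {x} → x ∈ L →
              + remP r x ≡ reprE b x ℤ.+ + reprF b x ℤ.* + k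
  remainder pr r≡1+kb S<k {x} x∈ = remP≡reprE+reprF*k x pr r≡1+kb (↧∣b x∈) (¬nni x∈)
    (ℕP.≤-<-trans (ℕP.≤-trans (∣reprE∣≤Nδ b x) (∈⇒≤sum (Nδ b) x∈)) S<k)
  gap : ∀ {r k} → Prime r → r ≡ suc (k ℕ.* b) → S ℕ.< k →
        + remP r γ' ℤ.- + remP r γ ≡ (e' ℤ.+ + F' ℤ.* + k) ℤ.- (e ℤ.+ + F ℤ.* + k)
  gap pr r≡1+kb S<k = cong₂ ℤ._-_ (remainder pr r≡1+kb S<k γ'∈) (remainder pr r≡1+kb S<k γ∈)
  small : F ≢ F' → ∣ e ∣ ℕ.+ ∣ e' ∣ ℕ.< kp
  small F≢F' = ℕP.≤-<-trans (ℕP.≤-trans (ℕP.+-mono-≤ (∣reprE∣≤Nδ b γ) (∣reprE∣≤Nδ b γ'))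
    (∈∧∈∧≢⇒+≤sum (Nδ b) γ∈ γ'∈ (F≢F' ∘ cong (reprF b)))) S<kp
  ordered-at-kp : e ℤ.+ + F ℤ.* + kp ℤ.< e' ℤ.+ + F' ℤ.* + kp
  ordered-at-kp = subst₂ ℤ._<_ (remainder pp p≡1+kp*b S<kp γ∈) (remainder pp p≡1+kp*b S<kp γ'∈) (ℤ.+<+ ordered)

proposition4p5 : (d : ℕ) (α β : Vec ℚ d) →
    (∀ i → ¬ NonNegInt (lookup α i)) → (∀ i → ¬ NonNegInt (lookup β i)) →
    (p q : ℕ) → Prime p → Prime q →
    ≡1mod p (lcd (AB α β)) → ≡1mod q (lcd (AB α β)) →
    Nr (AB α β) < p → p < q →
    (γ γ' : ℚ) → γ ∈ AB α β → γ' ∈ AB α β → Prec-r (AB α β) γ γ' →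
    (¬ IsInt (γ ℚ.- γ'))
      ⇔ ((+ remP p γ' ℤ.- + remP p γ) ℤ.< (+ remP q γ' ℤ.- + remP q γ))
proposition4p5 d α β ¬nni-α ¬nni-β p q pp pq p≡1 q≡1 Nr<p p<q γ γ' γ∈ γ'∈ γ≺γ' =
  remainder-gap-criterion (AB α β) (lcd (AB α β)) (∈⇒↧ₙ∣lcd (AB α β)) ¬nni
    pp pq p≡1 q≡1 Nr<p p<q γ∈ γ'∈ (γ≺γ' p pp p≡1 Nr<p)
  where
  ¬nni : ∀ {x} → x ∈ AB α β → ¬ NonNegInt x
  ¬nni x∈ = [ ∀lookup⇒∀∈toList α ¬nni-α , ∀lookup⇒∀∈toList β ¬nni-β ]′ (∈-++⁻ (toList α) x∈)
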